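{- Let $\mathcal S$ be a polynomially bounded simple disjunctive loop, let $\vec p\in\mathrm{cl}(\mathcal S)$, and let $\vec q$ be an iterative fragment of $\vec p$ (i.e., $\vec q$ is iterative and $\vec q\sqsubseteq\vec p$). Then for every integer $i\ge1$: (1) $\vec q^{(i)}$ is iterative; (2) $\vec q^{(i)}\sqsubseteq\vec p^{(i)}$; (3) $\vec q^{(i)}\sqsubseteq\vec q^{(i+1)}$.
   Context: An abstract polynomial over $x_1,\dots,x_n$ is a finite set of monomials (coefficients in the Boolean semiring $\{0,1\}$); an AMP is an $n$-tuple of them; abstract composition $(\vec p\circ\vec q)[i]$ substitutes $\vec q[j]$ for $x_j$ in $\vec p[i]$; $\vec p^{(i)}$ is the $i$-fold composition. $\vec p\sqsubseteq\vec q$ if every monomial of $\vec p[i]$ appears in $\vec q[i]$ for all $i$. $\mathrm{sd}(\vec p)=\{i:x_i\text{ occurs in }\vec p[i]\}$; $\vec p$ is iterative if all variables of all monomials of all its components have indices in $\mathrm{sd}(\vec p)$. $\mathrm{Id}=\langle x_1,\dots,x_n\rangle$. A simple disjunctive loop (SDL) is a finite set $\mathcal S$ of AMPs, each read as a concrete map $\mathbb{N}^n\to\mathbb{N}^n$ with all coefficients $1$; it is polynomially bounded if there is an $n$-tuple $\vec b$ of polynomials in $x_1,\dots,x_n,t$ with $\vec p_t(\cdots\vec p_1(\vec x))\le\vec b(\vec x,t)$ for all $\vec x$, $t$, $\vec p_1,\dots,\vec p_t\in\mathcal S$. $\mathrm{cl}(\mathcal S)$ is the smallest set containing $\mathrm{Id}$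 and $\mathcal S$ closed under abstract composition. -}

module Defs where

open import Data.Nat using (ℕ; zero; suc; _+_; _*_; _^_; _≤_)
open import Data.Nat.Properties using () renaming (_≟_ to _≟ℕ_)
open import Data.Fin using (Fin; zero; suc)
open import Data.Vec using (Vec; lookup; replicate; zipWith; tabulate)
open import Data.Vec.Properties using (≡-dec)
open import Data.List using (List; []; _∷_; map; concatMap; foldr; deduplicate; length)
open import Data.Nat.ListAction using (sum)
open import Data.List.Relation.Unary.All using (All)
open import Data.List.Membership.Propositional using (_∈_)
open import Data.Fin.Base using (Fin)
open import Data.Product using (Σ; _×_; ∃; ∃-syntax)
open import Relation.Binary.PropositionalEquality using (_≡_)

Mono : ℕ → Set
Mono n = Vec ℕ n

-- Abstract polynomial: a finite set of monomials, represented by a list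
-- (read as the set of its elements; duplicates / order are irrelevant).
Poly : ℕ → Set
Poly n = List (Mono n)

AMP : ℕ → Set
AMP n = Fin n → Poly n

_·m_ : ∀ {n} → Mono n → Mono n → Mono n
_·m_ = zipWith _+_

oneM : ∀ {n} → Mono n
oneM = replicate _ 0

oneP : ∀ {n} → Poly n
oneP = oneM ∷ []

-- Product of abstract polynomials (Boolean semiring: set of products).
_⊗_ : ∀ {n} → Poly n → Poly n → Poly n
P ⊗ Q = concatMap (λ a → map (a ·m_) Q) P

_^P_ : ∀ {n} → Poly n → ℕ → Poly n
P ^P zero  = oneP
P ^P suc k = P ⊗ (P ^P k)

prodFin : ∀ {n} k → (Fin k → Poly n) → Poly n
prodFin zero    f = oneP
prodFin (suc k) f = f zero ⊗ prodFin k (λ j → f (suc j))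

substMono : ∀ {n} → Mono n → AMP n → Poly n
substMono {n} m q = prodFin n (λ j → q j ^P lookup m j)

_∘A_ : ∀ {n} → AMP n → AMP n → AMP n
(p ∘A q) i = concatMap (λ m → substMono m q) (p i)

unitMono : ∀ {n} → Fin n → Mono n
unitMono {zero}  ()
unitMono {suc n} zero    = tabulate (λ { zero → 1 ; (suc _) → 0 })
unitMono {suc n} (suc i) = tabulate (λ { zero → 0 ; (suc j) → lookup (unitMono i) j })

Id : ∀ {n} → AMP n
Id i = unitMono i ∷ []

iter : ∀ {n} → AMP n → ℕ → AMP n
iter p zero    = Id
iter p (suc i) = p ∘A iter p i

_⊑_ : ∀ {n} → AMP n → AMP n → Set
p ⊑ q = ∀ i {m} → m ∈ p i → m ∈ q i

occurs : ∀ {n} → Fin n → Mono n → Set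
occurs j m = 1 ≤ lookup m j

inSd : ∀ {n} → AMP n → Fin n → Set
inSd p j = ∃[ m ] (m ∈ p j × occurs j m)

Iterative : ∀ {n} → AMP n → Set
Iterative p = ∀ i {m} → m ∈ p i → ∀ j → occurs j m → inSd p j

evalMono : ∀ {k} → Mono k → (Fin k → ℕ) → ℕ
evalMono {zero}  m x = 1
evalMono {suc k} m x =
  x zero ^ lookup m zero * evalMono {k} (tabulate (λ j → lookup m (suc j))) (λ j → x (suc j))

-- An abstract polynomial as a concrete polynomial with all coefficients 1
-- (duplicates removed, since the list stands for a set).
evalPoly : ∀ {n} → Poly n → (Fin n → ℕ) → ℕ
evalPoly P x = sum (map (λ m → evalMono m x) (deduplicate (≡-dec _≟ℕ_) P))

evalAMP : ∀ {n} → AMP n → (Fin n → ℕ) → (Fin n → ℕ)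
evalAMP p x i = evalPoly (p i) x

run : ∀ {n} → List (AMP n) → (Fin n → ℕ) → (Fin n → ℕ)
run []       x = x
run (p ∷ ps) x = run ps (evalAMP p x)

-- Polynomial with natural-number coefficients over variables t, x_1..x_n
-- (variable index 0 is t); a list of monomials, coefficients = multiplicities.
NatPoly : ℕ → Set
NatPoly k = List (Mono k)

evalNatPoly : ∀ {k} → NatPoly k → (Fin k → ℕ) → ℕ
evalNatPoly P x = sum (map (λ m → evalMono m x) P)

extend : ∀ {n} → (Fin n → ℕ) → ℕ → Fin (suc n) → ℕ
extend x t zero    = t
extend x t (suc j) = x j

SDL : ℕ → Set
SDL n = List (AMP n)

PolyBounded : ∀ {n} → SDL n → Set
PolyBounded {n} S =
  Σ (Fin n → NatPoly (suc n)) λ b →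
    ∀ (ps : List (AMP n)) → All (_∈ S) ps → ∀ (x : Fin n → ℕ) (i : Fin n) →
      run ps x i ≤ evalNatPoly (b i) (extend x (length ps))

-- cl(S): smallest set containing Id and S, closed under abstract composition.
-- AMPs are lists standing for sets, so membership is closed under
-- set-equality (mutual ⊑).
data Cl {n} (S : SDL n) : AMP n → Set where
  cl-id   : Cl S Id
  cl-S    : ∀ {p} → p ∈ S → Cl S p
  cl-comp : ∀ {p q} → Cl S p → Cl S q → Cl S (p ∘A q)
  cl-eq   : ∀ {p p′} → Cl S p → p ⊑ p′ → p′ ⊑ p → Cl S p′

module Submission where

-- Suppose some monomial of q[j] containing x_j were not x_j itself; then it is divisible by x_j x_l
-- for some l.  Evaluate at the constant point B.  Since q ⊑ p and q is iterative, every component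
-- l ∈ sd(q) of p^(t) has a monomial worth at least B, and component j gains a factor B at each step,
-- so p^(t)[j] has a monomial worth at least B^(t+1).  On the other hand p ∈ cl(S) is dominated by a
-- run of L loop steps, so p^(t) is dominated by a run of tL steps, and the polynomial bound of the loop
-- (N monomials, degree sum D) caps that run by N B^D as soon as B ≥ tL.  With t = D and B = 1 + N + DL
-- this is a contradiction.  Hence x_j ∈ q[j] for all j ∈ sd(q), and the three claims become
-- combinatorial: q^(i) ⊑ q^(i+1) by induction, so x_l ∈ q^(i)[l], while the variables of q^(i) stay in sd(q).

open import Defs
open import Data.Nat using (ℕ; zero; suc; _+_; _*_; _^_; _≤_; _<_; z≤n; s≤s; z<s; NonZero; >-nonZero; >-nonZero⁻¹)
open import Data.Nat.Properties
open import Data.Nat.ListAction using (sum)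
open import Data.Fin using (Fin; zero; suc)
open import Data.Fin.Properties using (¬∀⟶∃¬) renaming (_≟_ to _≟ᶠ_; suc-injective to suc-injectiveᶠ)
open import Data.Vec as Vec using (Vec; []; _∷_; lookup; tabulate)
open import Data.Vec.Properties using (lookup∘tabulate; tabulate∘lookup; tabulate-cong; lookup-zipWith; lookup-replicate; zipWith-identityʳ; zipWith-identityˡ; ≡-dec)
open import Data.Vec.Functional using (updateAt)
open import Data.Vec.Functional.Properties using (updateAt-updates; updateAt-minimal)
open import Data.List using (List; []; _∷_; map; _++_; length)
open import Data.List.Properties using (length-++)
open import Data.List.Relation.Unary.Any using (here; there)
open import Data.List.Relation.Unary.All using (All; []; _∷_)
open import Data.List.Relation.Unary.All.Properties using (++⁺)
open import Data.List.Membership.Propositional using (_∈_; find; lose)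
open import Data.List.Membership.Propositional.Properties using (∈-concatMap⁺; ∈-concatMap⁻; ∈-map⁺; ∈-map⁻; ∈-deduplicate⁺)
open import Data.List.Relation.Binary.Subset.Propositional using (_⊆_)
open import Data.Product using (_×_; _,_; proj₂; ∃-syntax)
open import Data.Sum using (_⊎_; inj₁; inj₂; [_,_]′)
open import Data.Empty using (⊥; ⊥-elim)
open import Function using (_∘_)
open import Relation.Nullary using (¬_; yes; no)
open import Relation.Binary.PropositionalEquality

∏ : ∀ k → (Fin k → ℕ) → ℕ
∏ zero    f = 1
∏ (suc k) f = f zero * ∏ k (f ∘ suc)

∏-mono-≤ : ∀ k {f g : Fin k → ℕ} → (∀ j → f j ≤ g j) → ∏ k f ≤ ∏ k g
∏-mono-≤ zero    f≤g = ≤-refl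
∏-mono-≤ (suc k) f≤g = *-mono-≤ (f≤g zero) (∏-mono-≤ k (f≤g ∘ suc))

evalMono-∷ : ∀ {k} a (as : Vec ℕ k) x → evalMono (a ∷ as) x ≡ x zero ^ a * evalMono as (x ∘ suc)
evalMono-∷ a as x = cong (λ v → x zero ^ a * evalMono v (x ∘ suc)) (tabulate∘lookup as)

evalMono≡∏ : ∀ {k} (m : Mono k) x → evalMono m x ≡ ∏ k (λ j → x j ^ lookup m j)
evalMono≡∏ []       x = refl
evalMono≡∏ (a ∷ as) x = trans (evalMono-∷ a as x) (cong (x zero ^ a *_) (evalMono≡∏ as (x ∘ suc)))

evalMono-·m : ∀ {k} (a b : Mono k) x → evalMono (a ·m b) x ≡ evalMono a x * evalMono b x
evalMono-·m []       []       x = refl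
evalMono-·m (a ∷ as) (b ∷ bs) x = begin
    evalMono ((a + b) ∷ (as ·m bs)) x
  ≡⟨ evalMono-∷ (a + b) (as ·m bs) x ⟩
    x zero ^ (a + b) * evalMono (as ·m bs) (x ∘ suc)
  ≡⟨ cong₂ _*_ (^-distribˡ-+-* (x zero) a b) (evalMono-·m as bs (x ∘ suc)) ⟩
    (x zero ^ a * x zero ^ b) * (evalMono as (x ∘ suc) * evalMono bs (x ∘ suc))
  ≡⟨ [m*n]*[o*p]≡[m*o]*[n*p] (x zero ^ a) _ _ _ ⟩
    (x zero ^ a * evalMono as (x ∘ suc)) * (x zero ^ b * evalMono bs (x ∘ suc))
  ≡⟨ sym (cong₂ _*_ (evalMono-∷ a as x) (evalMono-∷ b bs x)) ⟩
    evalMono (a ∷ as) x * evalMono (b ∷ bs) x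
  ∎
  where open ≡-Reasoning

evalMono-zeros : ∀ {k} (m : Mono k) x → (∀ j → lookup m j ≡ 0) → evalMono m x ≡ 1
evalMono-zeros []       x _  = refl
evalMono-zeros (a ∷ as) x m≡0 rewrite evalMono-∷ a as x | m≡0 zero =
  trans (+-identityʳ _) (evalMono-zeros as (x ∘ suc) (m≡0 ∘ suc))

evalMono-oneM : ∀ {k} x → evalMono (oneM {k}) x ≡ 1
evalMono-oneM x = evalMono-zeros oneM x (λ j → lookup-replicate j 0)

evalMono-unitMono : ∀ {k} (i : Fin k) x → evalMono (unitMono i) x ≡ x i
evalMono-unitMono {suc k} zero x =
  trans (cong (x zero ^ 1 *_) (evalMono-zeros _ (x ∘ suc) (λ j → trans (lookup∘tabulate _ j) (lookup∘tabulate _ j))))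
        (trans (*-identityʳ _) (*-identityʳ _))
evalMono-unitMono {suc k} (suc i) x rewrite evalMono-∷ 0 (tabulate (lookup (unitMono i))) x
                                          | tabulate∘lookup (unitMono i) =
  trans (+-identityʳ _) (evalMono-unitMono i (x ∘ suc))

lookup-unitMono-≡ : ∀ {k} (j : Fin k) → lookup (unitMono j) j ≡ 1
lookup-unitMono-≡ {suc k} zero    = refl
lookup-unitMono-≡ {suc k} (suc j) = trans (lookup∘tabulate _ j) (lookup-unitMono-≡ j)

lookup-unitMono-≢ : ∀ {k} (j l : Fin k) → j ≢ l → lookup (unitMono j) l ≡ 0
lookup-unitMono-≢ {suc k} zero    zero    j≢l = ⊥-elim (j≢l refl)
lookup-unitMono-≢ {suc k} zero    (suc l) _   = lookup∘tabulate _ l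
lookup-unitMono-≢ {suc k} (suc j) zero    _   = refl
lookup-unitMono-≢ {suc k} (suc j) (suc l) j≢l =
  trans (lookup∘tabulate _ l) (lookup-unitMono-≢ j l (j≢l ∘ cong suc))

occurs-unitMono⁻ : ∀ {k} {j l : Fin k} → occurs l (unitMono j) → l ≡ j
occurs-unitMono⁻ {j = j} {l} o with l ≟ᶠ j
... | yes l≡j = l≡j
... | no  l≢j with () ← subst (1 ≤_) (lookup-unitMono-≢ j l (l≢j ∘ sym)) o

infix 4 _∣ₘ_
_∣ₘ_ : ∀ {n} → Mono n → Mono n → Set
a ∣ₘ b = ∀ i → lookup a i ≤ lookup b i

evalMono-mono-∣ₘ : ∀ {k} {a b : Mono k} x → (∀ l → 0 < x l) → a ∣ₘ b → evalMono a x ≤ evalMono b x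
evalMono-mono-∣ₘ {k} {a} {b} x x>0 a∣b = begin
  evalMono a x                   ≡⟨ evalMono≡∏ a x ⟩
  ∏ k (λ j → x j ^ lookup a j)   ≤⟨ ∏-mono-≤ k (λ j → ^-monoʳ-≤ (x j) {{>-nonZero (x>0 j)}} (a∣b j)) ⟩
  ∏ k (λ j → x j ^ lookup b j)   ≡⟨ evalMono≡∏ b x ⟨
  evalMono b x                   ∎
  where open ≤-Reasoning

unitMono-∣ₘ : ∀ {n} (m : Mono n) j → occurs j m → unitMono j ∣ₘ m
unitMono-∣ₘ m j o i with j ≟ᶠ i
... | yes refl rewrite lookup-unitMono-≡ j = o
... | no  j≢i  rewrite lookup-unitMono-≢ j i j≢i = z≤n

unitMono²-∣ₘ : ∀ {n} (m : Mono n) j l → occurs j m → occurs l m → (j ≡ l → 2 ≤ lookup m j) →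
               unitMono j ·m unitMono l ∣ₘ m
unitMono²-∣ₘ m j l oj ol two i rewrite lookup-zipWith _+_ i (unitMono j) (unitMono l) with j ≟ᶠ i | l ≟ᶠ i
... | yes refl | yes refl rewrite lookup-unitMono-≡ j                                    = two refl
... | yes refl | no  l≢j  rewrite lookup-unitMono-≡ j | lookup-unitMono-≢ l j l≢j        = oj
... | no  j≢i  | yes refl rewrite lookup-unitMono-≢ j l j≢i | lookup-unitMono-≡ l        = ol
... | no  j≢i  | no  l≢i  rewrite lookup-unitMono-≢ j i j≢i | lookup-unitMono-≢ l i l≢i = z≤n

nonUnit-∣ₘ : ∀ {n} (m : Mono n) j → occurs j m → m ≢ unitMono j → ∃[ l ] (unitMono j ·m unitMono l ∣ₘ m)
nonUnit-∣ₘ {n} m j oj m≢u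
  with ¬∀⟶∃¬ n (λ l → lookup m l ≡ lookup (unitMono j) l) (λ l → lookup m l ≟ lookup (unitMono j) l)
             (m≢u ∘ lookup-ext)
  where
    lookup-ext : (∀ l → lookup m l ≡ lookup (unitMono j) l) → m ≡ unitMono j
    lookup-ext eq = trans (sym (tabulate∘lookup m)) (trans (tabulate-cong eq) (tabulate∘lookup (unitMono j)))
... | l , differs with l ≟ᶠ j
... | yes refl = l , unitMono²-∣ₘ m l l oj oj (λ _ → ≤∧≢⇒< oj (λ 1≡m → differs (trans (sym 1≡m) (sym (lookup-unitMono-≡ l)))))
... | no  l≢j  = l , unitMono²-∣ₘ m j l oj (n≢0⇒n>0 (λ m≡0 → differs (trans m≡0 (sym (lookup-unitMono-≢ j l (l≢j ∘ sym))))))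
                                           (⊥-elim ∘ l≢j ∘ sym)

∈-⊗⁺ : ∀ {n} {P Q : Poly n} {a b} → a ∈ P → b ∈ Q → a ·m b ∈ P ⊗ Q
∈-⊗⁺ {Q = Q} {a} a∈ b∈ = ∈-concatMap⁺ (λ a → map (a ·m_) Q) (lose a∈ (∈-map⁺ (a ·m_) b∈))

∈-⊗⁻ : ∀ {n} (P Q : Poly n) {c} → c ∈ P ⊗ Q → ∃[ a ] ∃[ b ] (a ∈ P × b ∈ Q × c ≡ a ·m b)
∈-⊗⁻ P Q c∈ with find (∈-concatMap⁻ (λ a → map (a ·m_) Q) {xs = P} c∈)
... | a , a∈ , c∈aQ with ∈-map⁻ (a ·m_) c∈aQ
... | b , b∈ , c≡ab = a , b , a∈ , b∈ , c≡ab

∈-∘A⁺ : ∀ {n} (p r : AMP n) {i m a} → m ∈ p i → a ∈ substMono m r → a ∈ (p ∘A r) i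
∈-∘A⁺ p r m∈ a∈ = ∈-concatMap⁺ (λ m → substMono m r) (lose m∈ a∈)

∈-∘A⁻ : ∀ {n} (p r : AMP n) {i a} → a ∈ (p ∘A r) i → ∃[ m ] (m ∈ p i × a ∈ substMono m r)
∈-∘A⁻ p r {i} a∈ = find (∈-concatMap⁻ (λ m → substMono m r) {xs = p i} a∈)

AllBelow : ∀ {n} → Poly n → (Fin n → ℕ) → ℕ → Set
AllBelow P x v = ∀ {a} → a ∈ P → evalMono a x ≤ v

oneP-allBelow : ∀ {n} x → AllBelow (oneP {n}) x 1
oneP-allBelow x (here refl) = ≤-reflexive (evalMono-oneM x)

⊗-allBelow : ∀ {n} {P Q : Poly n} {x u v} → AllBelow P x u → AllBelow Q x v → AllBelow (P ⊗ Q) x (u * v)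
⊗-allBelow {P = P} {Q} {x} P≤u Q≤v c∈ with ∈-⊗⁻ P Q c∈
... | a , b , a∈ , b∈ , refl = ≤-trans (≤-reflexive (evalMono-·m a b x)) (*-mono-≤ (P≤u a∈) (Q≤v b∈))

prodFin-allBelow : ∀ {n} k {f : Fin k → Poly n} {x c} →
                   (∀ j → AllBelow (f j) x (c j)) → AllBelow (prodFin k f) x (∏ k c)
prodFin-allBelow zero    _   = oneP-allBelow _
prodFin-allBelow (suc k) f≤c = ⊗-allBelow (f≤c zero) (prodFin-allBelow k (f≤c ∘ suc))

^P-allBelow : ∀ {n} {P : Poly n} {x v} → AllBelow P x v → ∀ e → AllBelow (P ^P e) x (v ^ e)
^P-allBelow P≤v zero    = oneP-allBelow _
^P-allBelow P≤v (suc e) = ⊗-allBelow P≤v (^P-allBelow P≤v e)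

substMono-allBelow : ∀ {n} (m : Mono n) {r : AMP n} {x y} →
                     (∀ j → AllBelow (r j) x (y j)) → AllBelow (substMono m r) x (evalMono m y)
substMono-allBelow {n} m {y = y} r≤y =
  subst (AllBelow _ _) (sym (evalMono≡∏ m y)) (prodFin-allBelow n (λ j → ^P-allBelow (r≤y j) (lookup m j)))

SomeAbove : ∀ {n} → Poly n → (Fin n → ℕ) → ℕ → Set
SomeAbove P x v = ∃[ a ] (a ∈ P × v ≤ evalMono a x)

someAbove-≤ : ∀ {n} {P : Poly n} {x v w} → w ≤ v → SomeAbove P x v → SomeAbove P x w
someAbove-≤ w≤v (a , a∈ , v≤a) = a , a∈ , ≤-trans w≤v v≤a

oneP-someAbove : ∀ {n} x → SomeAbove (oneP {n}) x 1
oneP-someAbove x = oneM , here refl , ≤-reflexive (sym (evalMono-oneM x))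

⊗-someAbove : ∀ {n} {P Q : Poly n} {x u v} → SomeAbove P x u → SomeAbove Q x v → SomeAbove (P ⊗ Q) x (u * v)
⊗-someAbove {x = x} (a , a∈ , u≤a) (b , b∈ , v≤b) =
  a ·m b , ∈-⊗⁺ a∈ b∈ , ≤-trans (*-mono-≤ u≤a v≤b) (≤-reflexive (sym (evalMono-·m a b x)))

prodFin-someAbove : ∀ {n} k {f : Fin k → Poly n} {x c} →
                    (∀ j → SomeAbove (f j) x (c j)) → SomeAbove (prodFin k f) x (∏ k c)
prodFin-someAbove zero    _   = oneP-someAbove _
prodFin-someAbove (suc k) c≤f = ⊗-someAbove (c≤f zero) (prodFin-someAbove k (c≤f ∘ suc))

^P-someAbove : ∀ {n} {P : Poly n} {x v} e → (1 ≤ e → SomeAbove P x v) → SomeAbove (P ^P e) x (v ^ e)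
^P-someAbove zero    _   = oneP-someAbove _
^P-someAbove (suc e) v≤P = ⊗-someAbove (v≤P z<s) (^P-someAbove e (λ _ → v≤P z<s))

substMono-someAbove : ∀ {n} (m : Mono n) {r : AMP n} {x v} →
                      (∀ j → occurs j m → SomeAbove (r j) x (v j)) → SomeAbove (substMono m r) x (evalMono m v)
substMono-someAbove {n} m {v = v} v≤r =
  subst (SomeAbove _ _) (sym (evalMono≡∏ m v)) (prodFin-someAbove n (λ j → ^P-someAbove (lookup m j) (v≤r j)))

∘A-someAbove : ∀ {n} {p r : AMP n} {i m x v} → m ∈ p i →
               (∀ j → occurs j m → SomeAbove (r j) x (v j)) → SomeAbove ((p ∘A r) i) x (evalMono m v)
∘A-someAbove {p = p} {r} {m = m} m∈ v≤r with substMono-someAbove m v≤r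
... | a , a∈ , m≤a = a , ∈-∘A⁺ p r m∈ a∈ , m≤a

OccursIn : ∀ {n} → Poly n → Fin n → Set
OccursIn P l = ∃[ a ] (a ∈ P × occurs l a)

oneP-occurs⁻ : ∀ {n} {l : Fin n} → ¬ OccursIn oneP l
oneP-occurs⁻ {l = l} (_ , here refl , o) with () ← subst (1 ≤_) (lookup-replicate l 0) o

⊗-occurs⁻ : ∀ {n} {P Q : Poly n} {l} → OccursIn (P ⊗ Q) l → OccursIn P l ⊎ OccursIn Q l
⊗-occurs⁻ {P = P} {Q} {l} (c , c∈ , o) with ∈-⊗⁻ P Q c∈
... | a , b , a∈ , b∈ , refl rewrite lookup-zipWith _+_ l a b =
  [ (λ oa → inj₁ (a , a∈ , oa)) , (λ ob → inj₂ (b , b∈ , ob)) ]′ (positive-summand (lookup a l) o)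
  where
    positive-summand : ∀ x {y} → 0 < x + y → 0 < x ⊎ 0 < y
    positive-summand zero    0<y = inj₂ 0<y
    positive-summand (suc x) _   = inj₁ z<s

prodFin-occurs⁻ : ∀ {n} k {f : Fin k → Poly n} {l} → OccursIn (prodFin k f) l → ∃[ j ] OccursIn (f j) l
prodFin-occurs⁻ zero    occ = ⊥-elim (oneP-occurs⁻ occ)
prodFin-occurs⁻ (suc k) occ with ⊗-occurs⁻ occ
... | inj₁ occ₀ = zero , occ₀
... | inj₂ occ′ with prodFin-occurs⁻ k occ′
...   | j , occⱼ = suc j , occⱼ

^P-occurs⁻ : ∀ {n} {P : Poly n} e {l} → OccursIn (P ^P e) l → 1 ≤ e × OccursIn P l
^P-occurs⁻ zero    occ = ⊥-elim (oneP-occurs⁻ occ)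
^P-occurs⁻ (suc e) occ = z<s , [ (λ occ₁ → occ₁) , proj₂ ∘ ^P-occurs⁻ e ]′ (⊗-occurs⁻ occ)

substMono-occurs⁻ : ∀ {n} (m : Mono n) {r : AMP n} {l} →
                    OccursIn (substMono m r) l → ∃[ j ] (occurs j m × OccursIn (r j) l)
substMono-occurs⁻ {n} m occ with prodFin-occurs⁻ n occ
... | j , occⱼ = j , ^P-occurs⁻ (lookup m j) occⱼ

∘A-occurs⁻ : ∀ {n} (p r : AMP n) {i l} →
             OccursIn ((p ∘A r) i) l → ∃[ m ] (m ∈ p i × ∃[ j ] (occurs j m × OccursIn (r j) l))
∘A-occurs⁻ p r (a , a∈ , o) with ∈-∘A⁻ p r a∈
... | m , m∈ , a∈′ = m , m∈ , substMono-occurs⁻ m (a , a∈′ , o)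

⊗-mono : ∀ {n} {P P′ Q Q′ : Poly n} → P ⊆ P′ → Q ⊆ Q′ → P ⊗ Q ⊆ P′ ⊗ Q′
⊗-mono {P = P} {Q = Q} P⊆P′ Q⊆Q′ c∈ with ∈-⊗⁻ P Q c∈
... | a , b , a∈ , b∈ , refl = ∈-⊗⁺ (P⊆P′ a∈) (Q⊆Q′ b∈)

prodFin-mono : ∀ {n} k {f g : Fin k → Poly n} → (∀ j → f j ⊆ g j) → prodFin k f ⊆ prodFin k g
prodFin-mono zero    _   = λ a∈ → a∈
prodFin-mono (suc k) f⊆g = ⊗-mono (f⊆g zero) (prodFin-mono k (f⊆g ∘ suc))

^P-mono : ∀ {n} {P Q : Poly n} e → (1 ≤ e → P ⊆ Q) → P ^P e ⊆ Q ^P e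
^P-mono zero    _   = λ a∈ → a∈
^P-mono (suc e) P⊆Q = ⊗-mono (P⊆Q z<s) (^P-mono e (λ _ → P⊆Q z<s))

substMono-mono : ∀ {n} (m : Mono n) {r r′ : AMP n} → (∀ j → occurs j m → r j ⊆ r′ j) → substMono m r ⊆ substMono m r′
substMono-mono {n} m r⊆r′ = prodFin-mono n (λ j → ^P-mono (lookup m j) (r⊆r′ j))

∘A-mono : ∀ {n} {p p′ r r′ : AMP n} → p ⊑ p′ →
          (∀ i {m} → m ∈ p i → ∀ j → occurs j m → r j ⊆ r′ j) → (p ∘A r) ⊑ (p′ ∘A r′)
∘A-mono {p = p} {p′} {r} {r′} p⊑p′ r⊆r′ i a∈ with ∈-∘A⁻ p r a∈
... | m , m∈ , a∈′ = ∈-∘A⁺ p′ r′ (p⊑p′ i m∈) (substMono-mono m (r⊆r′ i m∈) a∈′)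

oneM∈prodFin : ∀ {n} k {f : Fin k → Poly n} → (∀ j → oneM ∈ f j) → oneM ∈ prodFin k f
oneM∈prodFin zero    _  = here refl
oneM∈prodFin (suc k) {f} 1∈ = subst (_∈ prodFin (suc k) f) (zipWith-identityʳ +-identityʳ oneM) (∈-⊗⁺ (1∈ zero) (oneM∈prodFin k (1∈ ∘ suc)))

∈-prodFin-single : ∀ {n} k {f : Fin k → Poly n} (l : Fin k) {a} →
                   a ∈ f l → (∀ j → j ≢ l → oneM ∈ f j) → a ∈ prodFin k f
∈-prodFin-single (suc k) {f} zero {a} a∈ 1∈ =
  subst (_∈ prodFin (suc k) f) (zipWith-identityʳ +-identityʳ a) (∈-⊗⁺ a∈ (oneM∈prodFin k (λ j → 1∈ (suc j) (λ ()))))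
∈-prodFin-single (suc k) {f} (suc l) {a} a∈ 1∈ =
  subst (_∈ prodFin (suc k) f) (zipWith-identityˡ +-identityˡ a)
        (∈-⊗⁺ (1∈ zero (λ ())) (∈-prodFin-single k l a∈ (λ j j≢l → 1∈ (suc j) (j≢l ∘ suc-injectiveᶠ))))

∈-substMono-unitMono : ∀ {n} {r : AMP n} {l a} → a ∈ r l → a ∈ substMono (unitMono l) r
∈-substMono-unitMono {n} {r} {l} {a} a∈ = ∈-prodFin-single n l exponent-one exponent-zero
  where
    exponent-one : a ∈ r l ^P lookup (unitMono l) l
    exponent-one rewrite lookup-unitMono-≡ l = subst (_∈ r l ^P 1) (zipWith-identityʳ +-identityʳ a) (∈-⊗⁺ a∈ (here refl))
    exponent-zero : ∀ j → j ≢ l → oneM ∈ r j ^P lookup (unitMono l) j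
    exponent-zero j j≢l rewrite lookup-unitMono-≢ l j (j≢l ∘ sym) = here refl

unitMono∈⇒⊆∘A : ∀ {n} {p r : AMP n} {l} → unitMono l ∈ p l → r l ⊆ (p ∘A r) l
unitMono∈⇒⊆∘A {p = p} {r} u∈ a∈ = ∈-∘A⁺ p r u∈ (∈-substMono-unitMono a∈)

DominatedBy : ∀ {n} → AMP n → List (AMP n) → Set
DominatedBy p ps = ∀ x i → AllBelow (p i) x (run ps x i)

run-++ : ∀ {n} (rs ps : List (AMP n)) x → run (rs ++ ps) x ≡ run ps (run rs x)
run-++ []       ps x = refl
run-++ (r ∷ rs) ps x = run-++ rs ps (evalAMP r x)

Id-dominated : ∀ {n} → DominatedBy {n} Id []
Id-dominated x i (here refl) = ≤-reflexive (evalMono-unitMono i x)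

self-dominated : ∀ {n} (p : AMP n) → DominatedBy p (p ∷ [])
self-dominated p x i m∈ = ∈⇒≤sum (∈-deduplicate⁺ (≡-dec _≟_) m∈)
  where
    ∈⇒≤sum : ∀ {m ms} → m ∈ ms → evalMono m x ≤ sum (map (λ m → evalMono m x) ms)
    ∈⇒≤sum (here refl)            = m≤m+n _ _
    ∈⇒≤sum {ms = m′ ∷ _} (there m∈) = ≤-trans (∈⇒≤sum m∈) (m≤n+m _ (evalMono m′ x))

∘A-dominated : ∀ {n} {p r : AMP n} ps rs → DominatedBy p ps → DominatedBy r rs → DominatedBy (p ∘A r) (rs ++ ps)
∘A-dominated {p = p} {r} ps rs p≤ps r≤rs x i a∈ with ∈-∘A⁻ p r a∈
... | m , m∈ , a∈′ = begin
  evalMono _ x         ≤⟨ substMono-allBelow m (r≤rs x) a∈′ ⟩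
  evalMono m (run rs x) ≤⟨ p≤ps (run rs x) i m∈ ⟩
  run ps (run rs x) i  ≡⟨ cong (λ y → y i) (run-++ rs ps x) ⟨
  run (rs ++ ps) x i   ∎
  where open ≤-Reasoning

Cl-dominated : ∀ {n} {S : SDL n} {p} → Cl S p → ∃[ ps ] (All (_∈ S) ps × DominatedBy p ps)
Cl-dominated cl-id = [] , [] , Id-dominated
Cl-dominated (cl-S {p} p∈) = p ∷ [] , p∈ ∷ [] , self-dominated p
Cl-dominated (cl-comp cp cr) with Cl-dominated cp | Cl-dominated cr
... | ps , ps∈S , p≤ps | rs , rs∈S , r≤rs = rs ++ ps , ++⁺ rs∈S ps∈S , ∘A-dominated ps rs p≤ps r≤rs
Cl-dominated (cl-eq cp _ p′⊑p) with Cl-dominated cp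
... | ps , ps∈S , p≤ps = ps , ps∈S , λ x i m∈ → p≤ps x i (p′⊑p i m∈)

repeated : ∀ {A : Set} → List A → ℕ → List A
repeated xs zero    = []
repeated xs (suc t) = repeated xs t ++ xs

iter-dominated : ∀ {n} {p : AMP n} ps → DominatedBy p ps → ∀ t → DominatedBy (iter p t) (repeated ps t)
iter-dominated ps p≤ps zero    = Id-dominated
iter-dominated ps p≤ps (suc t) = ∘A-dominated ps (repeated ps t) p≤ps (iter-dominated ps p≤ps t)

All-repeated : ∀ {A : Set} {P : A → Set} {xs} → All P xs → ∀ t → All P (repeated xs t)
All-repeated _   zero    = []
All-repeated Pxs (suc t) = ++⁺ (All-repeated Pxs t) Pxs

length-repeated : ∀ {A : Set} (xs : List A) t → length (repeated xs t) ≡ t * length xs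
length-repeated xs zero    = refl
length-repeated xs (suc t) = begin
  length (repeated xs t ++ xs)          ≡⟨ length-++ (repeated xs t) ⟩
  length (repeated xs t) + length xs    ≡⟨ cong (_+ length xs) (length-repeated xs t) ⟩
  t * length xs + length xs             ≡⟨ +-comm (t * length xs) (length xs) ⟩
  suc t * length xs                     ∎
  where open ≡-Reasoning

degreeSum : ∀ {k} → NatPoly k → ℕ
degreeSum P = sum (map Vec.sum P)

evalMono-≤-^degree : ∀ {k} (m : Mono k) {y M} → (∀ i → y i ≤ M) → evalMono m y ≤ M ^ Vec.sum m
evalMono-≤-^degree []       _   = ≤-refl
evalMono-≤-^degree (a ∷ as) {y} {M} y≤M rewrite evalMono-∷ a as y | ^-distribˡ-+-* M a (Vec.sum as) =
  *-mono-≤ (^-monoˡ-≤ a (y≤M zero)) (evalMono-≤-^degree as (y≤M ∘ suc))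

evalNatPoly-≤ : ∀ {k} (P : NatPoly k) {y} M .{{_ : NonZero M}} → (∀ i → y i ≤ M) →
                evalNatPoly P y ≤ length P * M ^ degreeSum P
evalNatPoly-≤ []      M y≤M = z≤n
evalNatPoly-≤ (m ∷ P) M y≤M = +-mono-≤
  (≤-trans (evalMono-≤-^degree m y≤M) (^-monoʳ-≤ M (m≤m+n (Vec.sum m) (degreeSum P))))
  (≤-trans (evalNatPoly-≤ P M y≤M) (*-monoʳ-≤ (length P) (^-monoʳ-≤ M (m≤n+m (degreeSum P) (Vec.sum m)))))

module Growth {n} {p q : AMP n} (itq : Iterative q) (q⊑p : q ⊑ p) (B : ℕ) .{{_ : NonZero B}} where

  const-B : Fin n → ℕ
  const-B _ = B

  sd-someAbove : ∀ t k → inSd q k → SomeAbove (iter p t k) const-B B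
  sd-someAbove zero    k _             = unitMono k , here refl , ≤-reflexive (sym (evalMono-unitMono k const-B))
  sd-someAbove (suc t) k (m , m∈ , ok) =
    someAbove-≤ B≤m (∘A-someAbove {p = p} (q⊑p k m∈) (λ l ol → sd-someAbove t l (itq k m∈ l ol)))
    where
      B≤m : B ≤ evalMono m const-B
      B≤m = ≤-trans (≤-reflexive (sym (evalMono-unitMono k const-B)))
                    (evalMono-mono-∣ₘ const-B (λ _ → >-nonZero⁻¹ B) (unitMono-∣ₘ m k ok))

  superlinear-someAbove : ∀ {j l m} → m ∈ q j → unitMono j ·m unitMono l ∣ₘ m →
                          ∀ t → SomeAbove (iter p t j) const-B (B ^ suc t)
  superlinear-someAbove {j} m∈ _ zero =
    unitMono j , here refl , ≤-reflexive (trans (*-identityʳ B) (sym (evalMono-unitMono j const-B)))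
  superlinear-someAbove {j} {l} {m} m∈ jl∣m (suc t) =
    someAbove-≤ growth (∘A-someAbove {p = p} (q⊑p j m∈) feed)
    where
      v : Fin n → ℕ
      v = updateAt const-B j (λ _ → B ^ suc t)

      B≤v : ∀ i → B ≤ v i
      B≤v i with i ≟ᶠ j
      ... | yes refl = ≤-trans (m≤m*n B (B ^ t) {{m^n≢0 B t}}) (≤-reflexive (sym (updateAt-updates j const-B)))
      ... | no  i≢j  = ≤-reflexive (sym (updateAt-minimal i j const-B i≢j))

      feed : ∀ i → occurs i m → SomeAbove (iter p t i) const-B (v i)
      feed i oi with i ≟ᶠ j
      ... | yes refl = subst (SomeAbove _ _) (sym (updateAt-updates j const-B)) (superlinear-someAbove m∈ jl∣m t)
      ... | no  i≢j  = subst (SomeAbove _ _) (sym (updateAt-minimal i j const-B i≢j)) (sd-someAbove t i (itq j m∈ i oi))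

      growth : B ^ suc (suc t) ≤ evalMono m v
      growth = begin
        B * B ^ suc t                          ≡⟨ *-comm B (B ^ suc t) ⟩
        B ^ suc t * B                          ≤⟨ *-mono-≤ (≤-reflexive (sym (updateAt-updates j const-B))) (B≤v l) ⟩
        v j * v l                              ≡⟨ cong₂ _*_ (evalMono-unitMono j v) (evalMono-unitMono l v) ⟨
        evalMono (unitMono j) v * evalMono (unitMono l) v ≡⟨ evalMono-·m (unitMono j) (unitMono l) v ⟨
        evalMono (unitMono j ·m unitMono l) v  ≤⟨ evalMono-mono-∣ₘ v (λ i → ≤-trans (>-nonZero⁻¹ B) (B≤v i)) jl∣m ⟩
        evalMono m v                           ∎
        where open ≤-Reasoning

dominated⇒no-superlinear-selfLoop :
  ∀ {n} {S : SDL n} → PolyBounded S → ∀ {p q : AMP n} ps → All (_∈ S) ps → DominatedBy p ps →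
  Iterative q → q ⊑ p → ∀ {j l m} → m ∈ q j → ¬ (unitMono j ·m unitMono l ∣ₘ m)
dominated⇒no-superlinear-selfLoop (b , b-bounds) {p} ps ps∈S p≤ps itq q⊑p {j} m∈ jl∣m =
  contradiction-from (superlinear-someAbove m∈ jl∣m D)
  where
    N = length (b j)
    D = degreeSum (b j)
    B = suc (N + D * length ps)
    open Growth itq q⊑p B

    extend≤B : ∀ i → extend const-B (length (repeated ps D)) i ≤ B
    extend≤B zero    = ≤-trans (≤-reflexive (length-repeated ps D)) (≤-trans (m≤n+m (D * length ps) N) (n≤1+n _))
    extend≤B (suc i) = ≤-refl

    contradiction-from : SomeAbove (iter p D j) const-B (B ^ suc D) → ⊥
    contradiction-from (a , a∈ , B^sucD≤a) = <⇒≱ (*-monoˡ-< (B ^ D) {{m^n≢0 B D}} (s≤s (m≤m+n N (D * length ps)))) (begin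
      B ^ suc D                                                  ≤⟨ B^sucD≤a ⟩
      evalMono a const-B                                         ≤⟨ iter-dominated ps p≤ps D const-B j a∈ ⟩
      run (repeated ps D) const-B j                              ≤⟨ b-bounds (repeated ps D) (All-repeated ps∈S D) const-B j ⟩
      evalNatPoly (b j) (extend const-B (length (repeated ps D))) ≤⟨ evalNatPoly-≤ (b j) B extend≤B ⟩
      N * B ^ D                                                  ∎)
      where open ≤-Reasoning

unitMono∈selfLoops : ∀ {n} {S : SDL n} → PolyBounded S → ∀ {p q : AMP n} → Cl S p → Iterative q → q ⊑ p →
                     ∀ j → inSd q j → unitMono j ∈ q j
unitMono∈selfLoops bounded p∈cl itq q⊑p j (m , m∈ , oj) with ≡-dec _≟_ m (unitMono j)
... | yes refl = m∈
... | no  m≢u with nonUnit-∣ₘ m j oj m≢u | Cl-dominated p∈cl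
...   | l , jl∣m | ps , ps∈S , p≤ps = ⊥-elim (dominated⇒no-superlinear-selfLoop bounded ps ps∈S p≤ps itq q⊑p m∈ jl∣m)

iter-⊑ : ∀ {n} {p q : AMP n} → q ⊑ p → ∀ i → iter q i ⊑ iter p i
iter-⊑ q⊑p zero    k a∈ = a∈
iter-⊑ q⊑p (suc i)      = ∘A-mono q⊑p (λ _ _ j _ → iter-⊑ q⊑p i j)

module Iteration {n} {q : AMP n} (itq : Iterative q) (units : ∀ j → inSd q j → unitMono j ∈ q j) where

  iter-occurs⁻ : ∀ i {k l} → OccursIn (iter q (suc i) k) l → inSd q l
  iter-occurs⁻ zero occ with ∘A-occurs⁻ q Id occ
  ... | m , m∈ , j , oj , _ , here refl , ol = subst (inSd q) (sym (occurs-unitMono⁻ ol)) (itq _ m∈ j oj)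
  iter-occurs⁻ (suc i) occ with ∘A-occurs⁻ q (iter q (suc i)) occ
  ... | _ , _ , _ , _ , occⱼ = iter-occurs⁻ i occⱼ

  mutual
    ⊆-iter-suc : ∀ i l → inSd q l → iter q i l ⊆ iter q (suc i) l
    ⊆-iter-suc zero    l l∈sd = unitMono∈⇒⊆∘A {p = q} (units l l∈sd)
    ⊆-iter-suc (suc i) l _    = ⊑-iter-suc i l

    ⊑-iter-suc : ∀ i → iter q (suc i) ⊑ iter q (suc (suc i))
    ⊑-iter-suc i = ∘A-mono (λ _ m∈ → m∈) (λ k m∈ j oj → ⊆-iter-suc i j (itq k m∈ j oj))

  unitMono∈iter : ∀ i l → inSd q l → unitMono l ∈ iter q i l
  unitMono∈iter zero    l _    = here refl
  unitMono∈iter (suc i) l l∈sd = ⊆-iter-suc i l l∈sd (unitMono∈iter i l l∈sd)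

  iter-iterative : ∀ i → Iterative (iter q (suc i))
  iter-iterative i k {m} m∈ l ol = unitMono l , unitMono∈iter (suc i) l l∈sd , ≤-reflexive (sym (lookup-unitMono-≡ l))
    where
      l∈sd : inSd q l
      l∈sd = iter-occurs⁻ i (m , m∈ , ol)

lemmaA7 : ∀ {n} (S : SDL n) → PolyBounded S →
          ∀ (p q : AMP n) → Cl S p → Iterative q → q ⊑ p →
          ∀ (i : ℕ) → 1 ≤ i →
          Iterative (iter q i) × (iter q i ⊑ iter p i) × (iter q i ⊑ iter q (suc i))
lemmaA7 S bounded p q p∈cl itq q⊑p (suc i) _ = iter-iterative i , iter-⊑ q⊑p (suc i) , ⊑-iter-suc i
  where open Iteration itq (unitMono∈selfLoops bounded p∈cl itq q⊑p)
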